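{- Let $C$ be a self-dual $L$-code of length $n$. Then there is a polynomial $F(X_1,X_2,X_3)$, weighted homogeneous of weighted degree $n$ with respect to the weights $1,1,2$ of $X_1,X_2,X_3$, such that $$\mathrm{swe}_C(x,y,z)=F\bigl(x+y,\ x+z,\ x^2+y^2+2z^2\bigr).$$
   Context: Let $L=\{0,1,\omega,\bar\omega\}$ be the Klein four-group $\mathbf{Z}_2\times\mathbf{Z}_2$, with dot product $x\cdot y\in\mathbf{F}_2$ equal to $1$ iff $x,y$ are distinct and both nonzero, $0$ otherwise. On $L^n$: $(\mathbf{x},\mathbf{y})=\sum_i x_i\cdot y_i$. An $L$-code of length $n$ is a subgroup $C\subseteq L^n$; it is self-dual if $C=\{\mathbf{x}:(\mathbf{x},\mathbf{y})=0\ \forall\mathbf{y}\in C\}$. The symmetrized weight enumerator is $\mathrm{swe}_C(x,y,z)=\sum_{\mathbf{c}\in C}x^{n_0(\mathbf{c})}y^{n_1(\mathbf{c})}z^{n_2(\mathbf{c})}$, with $n_0,n_1,n_2$ the numbers of coordinates equal to $0$, to $1$, and to $\omega$ or $\bar\omega$. -}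

module Defs where

open import Data.Bool using (Bool; true; false; _xor_; _∧_; not)
open import Data.Nat using (ℕ; zero; suc)
import Data.Nat as N
open import Data.Vec using (Vec; []; _∷_; zipWith; replicate)
open import Data.List using (List; []; _∷_; concatMap; map; filter; foldr)
open import Data.Product using (_×_; _,_)
open import Data.Rational using (ℚ; 0ℚ; 1ℚ; _+_; _*_)
open import Relation.Binary.PropositionalEquality using (_≡_)

data L : Set where
  o one ω ω̄ : L

_⊕_ : L → L → L
o ⊕ b = b
a ⊕ o = a
one ⊕ one = o
one ⊕ ω = ω̄
one ⊕ ω̄ = ω
ω ⊕ one = ω̄
ω ⊕ ω = o
ω ⊕ ω̄ = one
ω̄ ⊕ one = ω
ω̄ ⊕ ω = one
ω̄ ⊕ ω̄ = o

nonzero : L → Bool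
nonzero o = false
nonzero _ = true

eqL : L → L → Bool
eqL o o = true
eqL one one = true
eqL ω ω = true
eqL ω̄ ω̄ = true
eqL _ _ = false

-- dot product L × L → F2 (F2 modelled by Bool with xor as addition):
-- 1 iff x, y distinct and both nonzero
_·_ : L → L → Bool
x · y = nonzero x ∧ nonzero y ∧ not (eqL x y)

inner : ∀ {n} → Vec L n → Vec L n → Bool
inner [] [] = false
inner (x ∷ xs) (y ∷ ys) = (x · y) xor inner xs ys

addV : ∀ {n} → Vec L n → Vec L n → Vec L n
addV = zipWith _⊕_

zeroV : ∀ n → Vec L n
zeroV n = replicate n o

-- An L-code is a subset of L^n (given by its characteristic function)
-- that is a subgroup.  (Inverses are automatic since every element
-- has order ≤ 2.)
record IsLCode (n : ℕ) (C : Vec L n → Bool) : Set where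
  field
    has-zero : C (zeroV n) ≡ true
    closed-add : ∀ x y → C x ≡ true → C y ≡ true → C (addV x y) ≡ true

IsSelfDual : (n : ℕ) → (Vec L n → Bool) → Set
IsSelfDual n C =
  ∀ x → (C x ≡ true → ∀ y → C y ≡ true → inner x y ≡ false)
      × ((∀ y → C y ≡ true → inner x y ≡ false) → C x ≡ true)

allVecs : ∀ n → List (Vec L n)
allVecs zero = [] ∷ []
allVecs (suc n) =
  concatMap (λ v → (o ∷ v) ∷ (one ∷ v) ∷ (ω ∷ v) ∷ (ω̄ ∷ v) ∷ []) (allVecs n)

_^_ : ℚ → ℕ → ℚ
q ^ zero = 1ℚ
q ^ suc k = q * (q ^ k)

sumℚ : List ℚ → ℚ
sumℚ = foldr _+_ 0ℚ

monoV : ∀ {n} → ℚ → ℚ → ℚ → Vec L n → ℚ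
monoV x y z [] = 1ℚ
monoV x y z (o ∷ v) = x * monoV x y z v
monoV x y z (one ∷ v) = y * monoV x y z v
monoV x y z (ω ∷ v) = z * monoV x y z v
monoV x y z (ω̄ ∷ v) = z * monoV x y z v

swe : (n : ℕ) → (Vec L n → Bool) → ℚ → ℚ → ℚ → ℚ
swe n C x y z = sumℚ (map (monoV x y z) (filter (λ v → C v Data.Bool.≟ true) (allVecs n)))
  where import Data.Bool

-- polynomials in X1, X2, X3 over ℚ: lists of terms (c, a, b, d) meaning c·X1^a X2^b X3^d
Poly3 : Set
Poly3 = List (ℚ × ℕ × ℕ × ℕ)

evalP : Poly3 → ℚ → ℚ → ℚ → ℚ
evalP p X1 X2 X3 = sumℚ (map (λ { (c , a , b , d) → c * ((X1 ^ a) * ((X2 ^ b) * (X3 ^ d))) }) p)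

wdeg : ℚ × ℕ × ℕ × ℕ → ℕ
wdeg (c , a , b , d) = a N.+ b N.+ 2 N.* d

2ℚ : ℚ
2ℚ = 1ℚ + 1ℚ

module Submission where

-- Write p = (x , y , z) and T(p) = ((x+y)/2 + z , (x+y)/2 - z , (x-y)/2).
--  (1) MacWilliams: for a self-dual code C with |C| = K, the character sum
--      Σ_{c ∈ C} χ⟨d,c⟩ equals K·[d ∈ C]; hence Σ_{c∈C} ∏ f̂(c_i) = K·Σ_{c∈C} ∏ f(c_i)
--      for every f : L → ℚ, where f̂ is the Fourier transform of f.  For the
--      letter weights f = (x,y,z,z) one has f̂ = 2·(letter weights at T p), so
--      2ⁿ·swe(T p) = K·swe(p).  As T is an involution and 2ⁿ + K > 0, swe(T p) = swe(p).
--  (2) Every letter weight is a linear form in u₁ = x+y, u₂ = x+z and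
--      w = x-y-2z, and w² = Q(u₁,u₂,u₃) with u₃ = x²+y²+2z².  Computing in
--      ℚ[u₁,u₂,u₃] ⊕ w·ℚ[u₁,u₂,u₃] therefore writes swe(p) = A + w·B with A of
--      weighted degree n (weights 1,1,2).  T fixes u₁, u₂, u₃ and negates w, so
--      by (1) swe(p) = A - w·B as well, whence swe(p) = A = F(u₁,u₂,u₃).

open import Defs
open import Data.Bool using (Bool; true; false; _xor_; _≟_)
open import Data.Bool.Properties using (⇔→≡)
open import Data.Nat using (ℕ; zero; suc)
import Data.Nat as ℕ
import Data.Nat.Properties as ℕ
open import Data.Vec using (Vec; []; _∷_)
open import Data.List using (List; []; _∷_; map; filter; concatMap; _++_)
open import Data.List.Properties using (map-++; map-cong; map-∘)
open import Data.List.Relation.Unary.All as All using (All; []; _∷_)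
import Data.List.Relation.Unary.All.Properties as All
open import Data.Product using (Σ; _×_; _,_; proj₁; proj₂)
open import Data.Rational using (ℚ; 0ℚ; 1ℚ; ½; _/_; _+_; _*_; -_; _-_; _≤_; _<_; 1/_; positive; Positive; NonZero)
open import Data.Rational.Properties as ℚ using (+-*-commutativeRing)
open import Data.Empty using (⊥-elim)
open import Function.Bundles using (mk⇔)
open import Relation.Nullary using (yes; no; ¬_)
open import Relation.Nullary.Decidable using (dec⇒maybe)
open import Relation.Binary.PropositionalEquality
open import Tactic.RingSolver.Core.AlmostCommutativeRing using (AlmostCommutativeRing; fromCommutativeRing)
open import Tactic.RingSolver using (solve-∀)
import Data.Integer as ℤ
import Data.Nat.Tactic.RingSolver as ℕ-Ring

ℚ-ring : AlmostCommutativeRing _ _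
ℚ-ring = fromCommutativeRing +-*-commutativeRing (λ q → dec⇒maybe (0ℚ ℚ.≟ q))

sum-++ : ∀ xs ys → sumℚ (xs ++ ys) ≡ sumℚ xs + sumℚ ys
sum-++ []       ys = sym (ℚ.+-identityˡ _)
sum-++ (x ∷ xs) ys = trans (cong (x +_) (sum-++ xs ys)) (sym (ℚ.+-assoc x _ _))

sum-cong : ∀ {A : Set} {g h : A → ℚ} (l : List A) → (∀ a → g a ≡ h a) →
           sumℚ (map g l) ≡ sumℚ (map h l)
sum-cong l g≗h = cong sumℚ (map-cong g≗h l)

sum-+ : ∀ {A : Set} (l : List A) (g h : A → ℚ) →
        sumℚ (map (λ a → g a + h a) l) ≡ sumℚ (map g l) + sumℚ (map h l)
sum-+ []      g h = refl
sum-+ (a ∷ l) g h = trans (cong (g a + h a +_) (sum-+ l g h))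
                          (interchange (g a) (h a) (sumℚ (map g l)) (sumℚ (map h l)))
  where
  interchange : ∀ a b c d → a + b + (c + d) ≡ a + c + (b + d)
  interchange = solve-∀ ℚ-ring

sum-scale : ∀ {A : Set} (l : List A) (k : ℚ) (g : A → ℚ) →
            sumℚ (map (λ a → k * g a) l) ≡ k * sumℚ (map g l)
sum-scale []      k g = sym (ℚ.*-zeroʳ k)
sum-scale (a ∷ l) k g = trans (cong (k * g a +_) (sum-scale l k g)) (sym (ℚ.*-distribˡ-+ k (g a) _))

sum-zero : ∀ {A : Set} (l : List A) → sumℚ (map (λ _ → 0ℚ) l) ≡ 0ℚ
sum-zero []      = refl
sum-zero (a ∷ l) = cong (0ℚ +_) (sum-zero l)

sum-concatMap : ∀ {A B : Set} (l : List A) (g : A → List B) (h : B → ℚ) →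
                sumℚ (map h (concatMap g l)) ≡ sumℚ (map (λ a → sumℚ (map h (g a))) l)
sum-concatMap []      g h = refl
sum-concatMap (a ∷ l) g h = begin
  sumℚ (map h (g a ++ concatMap g l))              ≡⟨ cong sumℚ (map-++ h (g a) (concatMap g l)) ⟩
  sumℚ (map h (g a) ++ map h (concatMap g l))      ≡⟨ sum-++ (map h (g a)) _ ⟩
  sumℚ (map h (g a)) + sumℚ (map h (concatMap g l)) ≡⟨ cong (sumℚ (map h (g a)) +_) (sum-concatMap l g h) ⟩
  sumℚ (map h (g a)) + sumℚ (map (λ a → sumℚ (map h (g a))) l) ∎
  where open ≡-Reasoning

sum-swap : ∀ {A B : Set} (l₁ : List A) (l₂ : List B) (g : A → B → ℚ) →
           sumℚ (map (λ a → sumℚ (map (g a) l₂)) l₁) ≡ sumℚ (map (λ b → sumℚ (map (λ a → g a b) l₁)) l₂)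
sum-swap []       l₂ g = sym (sum-zero l₂)
sum-swap (a ∷ l₁) l₂ g = trans (cong (sumℚ (map (g a) l₂) +_) (sum-swap l₁ l₂ g))
                               (sym (sum-+ l₂ (g a) (λ b → sumℚ (map (λ a → g a b) l₁))))

𝟙 : Bool → ℚ
𝟙 true  = 1ℚ
𝟙 false = 0ℚ

sum-filter : ∀ {A : Set} (P : A → Bool) (g : A → ℚ) (l : List A) →
             sumℚ (map g (filter (λ a → P a ≟ true) l)) ≡ sumℚ (map (λ a → 𝟙 (P a) * g a) l)
sum-filter P g [] = refl
sum-filter P g (a ∷ l) with P a
... | true  = cong₂ _+_ (sym (ℚ.*-identityˡ (g a))) (sum-filter P g l)
... | false = trans (sum-filter P g l)
                    (sym (trans (cong (_+ sumℚ (map (λ a → 𝟙 (P a) * g a) l)) (ℚ.*-zeroˡ (g a)))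
                                (ℚ.+-identityˡ _)))

sum-𝟙-nonneg : ∀ {A : Set} (P : A → Bool) (l : List A) → 0ℚ ≤ sumℚ (map (λ a → 𝟙 (P a)) l)
sum-𝟙-nonneg P []      = ℚ.≤-refl
sum-𝟙-nonneg P (a ∷ l) = ℚ.+-mono-≤ (𝟙-nonneg (P a)) (sum-𝟙-nonneg P l)
  where
  𝟙-nonneg : ∀ b → 0ℚ ≤ 𝟙 b
  𝟙-nonneg true  = ℚ.nonNegative⁻¹ 1ℚ
  𝟙-nonneg false = ℚ.≤-refl

L-elim : {P : L → Set} → P o → P one → P ω → P ω̄ → ∀ a → P a
L-elim p₀ p₁ p₂ p₃ o  = p₀
L-elim p₀ p₁ p₂ p₃ one = p₁
L-elim p₀ p₁ p₂ p₃ ω  = p₂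
L-elim p₀ p₁ p₂ p₃ ω̄  = p₃

⊕-cancelʳ : ∀ a b → (a ⊕ b) ⊕ b ≡ a
⊕-cancelʳ = L-elim (L-elim refl refl refl refl) (L-elim refl refl refl refl)
                   (L-elim refl refl refl refl) (L-elim refl refl refl refl)

·-addʳ : ∀ e a b → e · (a ⊕ b) ≡ (e · a) xor (e · b)
·-addʳ = L-elim
  (L-elim (L-elim refl refl refl refl) (L-elim refl refl refl refl) (L-elim refl refl refl refl) (L-elim refl refl refl refl))
  (L-elim (L-elim refl refl refl refl) (L-elim refl refl refl refl) (L-elim refl refl refl refl) (L-elim refl refl refl refl))
  (L-elim (L-elim refl refl refl refl) (L-elim refl refl refl refl) (L-elim refl refl refl refl) (L-elim refl refl refl refl))
  (L-elim (L-elim refl refl refl refl) (L-elim refl refl refl refl) (L-elim refl refl refl refl) (L-elim refl refl refl refl))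

addV-cancelʳ : ∀ {n} (c y : Vec L n) → addV (addV c y) y ≡ c
addV-cancelʳ []       []       = refl
addV-cancelʳ (c ∷ cs) (y ∷ ys) = cong₂ _∷_ (⊕-cancelʳ c y) (addV-cancelʳ cs ys)

elemsL : List L
elemsL = o ∷ one ∷ ω ∷ ω̄ ∷ []

sumL : (L → ℚ) → ℚ
sumL g = sumℚ (map g elemsL)

-- translation b ↦ b ⊕ a permutes L (as a product of two transpositions)
sumL-translate : ∀ a (g : L → ℚ) → sumL (λ b → g (b ⊕ a)) ≡ sumL g
sumL-translate o  g = refl
sumL-translate one g = swap₁₂₃₄ (g o) (g one) (g ω) (g ω̄)
  where
  swap₁₂₃₄ : ∀ a b c d → b + (a + (d + (c + 0ℚ))) ≡ a + (b + (c + (d + 0ℚ)))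
  swap₁₂₃₄ = solve-∀ ℚ-ring
sumL-translate ω  g = swap₁₃₂₄ (g o) (g one) (g ω) (g ω̄)
  where
  swap₁₃₂₄ : ∀ a b c d → c + (d + (a + (b + 0ℚ))) ≡ a + (b + (c + (d + 0ℚ)))
  swap₁₃₂₄ = solve-∀ ℚ-ring
sumL-translate ω̄  g = swap₁₄₂₃ (g o) (g one) (g ω) (g ω̄)
  where
  swap₁₄₂₃ : ∀ a b c d → d + (c + (b + (a + 0ℚ))) ≡ a + (b + (c + (d + 0ℚ)))
  swap₁₄₂₃ = solve-∀ ℚ-ring

sumV : (n : ℕ) → (Vec L n → ℚ) → ℚ
sumV n h = sumℚ (map h (allVecs n))

sumV-suc : ∀ n (h : Vec L (suc n) → ℚ) → sumV (suc n) h ≡ sumV n (λ v → sumL (λ a → h (a ∷ v)))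
sumV-suc n h = sum-concatMap (allVecs n) _ h

sumV-translate : ∀ n (a : Vec L n) (h : Vec L n → ℚ) → sumV n (λ v → h (addV v a)) ≡ sumV n h
sumV-translate zero    []       h = refl
sumV-translate (suc n) (a ∷ as) h = begin
  sumV (suc n) (λ v → h (addV v (a ∷ as)))               ≡⟨ sumV-suc n _ ⟩
  sumV n (λ v → sumL (λ b → h ((b ⊕ a) ∷ addV v as)))    ≡⟨ sum-cong (allVecs n) (λ v → sumL-translate a (λ b → h (b ∷ addV v as))) ⟩
  sumV n (λ v → sumL (λ b → h (b ∷ addV v as)))          ≡⟨ sumV-translate n as _ ⟩
  sumV n (λ v → sumL (λ b → h (b ∷ v)))                  ≡⟨ sym (sumV-suc n h) ⟩
  sumV (suc n) h                                         ∎
  where open ≡-Reasoning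

χ : Bool → ℚ
χ false = 1ℚ
χ true  = - 1ℚ

χ-xor : ∀ a b → χ (a xor b) ≡ χ a * χ b
χ-xor false false = refl
χ-xor false true  = refl
χ-xor true  false = refl
χ-xor true  true  = refl

χ-inner-addʳ : ∀ {n} (d c y : Vec L n) → χ (inner d (addV c y)) ≡ χ (inner d c) * χ (inner d y)
χ-inner-addʳ []       []       []       = refl
χ-inner-addʳ (d ∷ ds) (c ∷ cs) (y ∷ ys) = begin
  χ ((d · (c ⊕ y)) xor inner ds (addV cs ys))            ≡⟨ χ-xor (d · (c ⊕ y)) (inner ds (addV cs ys)) ⟩
  χ (d · (c ⊕ y)) * χ (inner ds (addV cs ys))            ≡⟨ cong₂ _*_ (trans (cong χ (·-addʳ d c y)) (χ-xor (d · c) (d · y)))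
                                                                        (χ-inner-addʳ ds cs ys) ⟩
  χ (d · c) * χ (d · y) * (χ (inner ds cs) * χ (inner ds ys)) ≡⟨ interchange (χ (d · c)) (χ (d · y)) (χ (inner ds cs)) (χ (inner ds ys)) ⟩
  χ (d · c) * χ (inner ds cs) * (χ (d · y) * χ (inner ds ys)) ≡⟨ sym (cong₂ _*_ (χ-xor (d · c) (inner ds cs)) (χ-xor (d · y) (inner ds ys))) ⟩
  χ ((d · c) xor inner ds cs) * χ ((d · y) xor inner ds ys) ∎
  where
  open ≡-Reasoning
  interchange : ∀ a b c d → a * b * (c * d) ≡ a * c * (b * d)
  interchange = solve-∀ ℚ-ring

χ-fixes-nonzero : ∀ s b → ¬ s ≡ 0ℚ → s ≡ χ b * s → b ≡ false
χ-fixes-nonzero s false s≢0 s≡χs = refl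
χ-fixes-nonzero s true  s≢0 s≡-s = ⊥-elim (s≢0 (begin
  s                  ≡⟨ halve s ⟩
  ½ * (s + s)        ≡⟨ cong (λ t → ½ * (s + t)) s≡-s ⟩
  ½ * (s + - 1ℚ * s) ≡⟨ cancel s ⟩
  0ℚ                 ∎))
  where
  open ≡-Reasoning
  halve : ∀ s → s ≡ ½ * (s + s)
  halve = solve-∀ ℚ-ring
  cancel : ∀ s → ½ * (s + - 1ℚ * s) ≡ 0ℚ
  cancel = solve-∀ ℚ-ring

prodF : ∀ {m} → (L → ℚ) → Vec L m → ℚ
prodF f []      = 1ℚ
prodF f (a ∷ v) = f a * prodF f v

hat : (L → ℚ) → L → ℚ
hat f a = sumL (λ b → χ (b · a) * f b)

prodF-hat : ∀ n (f : L → ℚ) (c : Vec L n) →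
            sumV n (λ d → χ (inner d c) * prodF f d) ≡ prodF (hat f) c
prodF-hat zero    f []       = refl
prodF-hat (suc n) f (c ∷ cs) = begin
  sumV (suc n) (λ d → χ (inner d (c ∷ cs)) * prodF f d)          ≡⟨ sumV-suc n _ ⟩
  sumV n (λ d → sumL (λ b → χ ((b · c) xor inner d cs) * (f b * prodF f d)))
    ≡⟨ sum-cong (allVecs n) (λ d → trans (sum-cong elemsL (split d)) (sum-scale elemsL (χ (inner d cs) * prodF f d) (λ b → χ (b · c) * f b))) ⟩
  sumV n (λ d → χ (inner d cs) * prodF f d * hat f c)             ≡⟨ sum-cong (allVecs n) (λ d → ℚ.*-comm _ (hat f c)) ⟩
  sumV n (λ d → hat f c * (χ (inner d cs) * prodF f d))           ≡⟨ sum-scale (allVecs n) (hat f c) _ ⟩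
  hat f c * sumV n (λ d → χ (inner d cs) * prodF f d)             ≡⟨ cong (hat f c *_) (prodF-hat n f cs) ⟩
  prodF (hat f) (c ∷ cs)                                          ∎
  where
  open ≡-Reasoning
  regroup : ∀ a t g p → a * t * (g * p) ≡ t * p * (a * g)
  regroup = solve-∀ ℚ-ring
  split : ∀ d b → χ ((b · c) xor inner d cs) * (f b * prodF f d)
                ≡ χ (inner d cs) * prodF f d * (χ (b · c) * f b)
  split d b = trans (cong (_* (f b * prodF f d)) (χ-xor (b · c) (inner d cs))) (regroup (χ (b · c)) (χ (inner d cs)) (f b) (prodF f d))

-- Self-dual codes and the MacWilliams identity

module SelfDualCode {n : ℕ} {C : Vec L n → Bool} (code : IsLCode n C) (selfDual : IsSelfDual n C) where
  open IsLCode code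

  size : ℚ
  size = sumV n (λ c → 𝟙 (C c))

  translate-invariant : ∀ y → C y ≡ true → ∀ c → C (addV c y) ≡ C c
  translate-invariant y y∈C c = ⇔→≡ (mk⇔ backward (λ c∈C → closed-add c y c∈C y∈C))
    where
    backward : C (addV c y) ≡ true → C c ≡ true
    backward c+y∈C = subst (λ v → C v ≡ true) (addV-cancelʳ c y) (closed-add (addV c y) y c+y∈C y∈C)

  charSum : Vec L n → ℚ
  charSum d = sumV n (λ c → 𝟙 (C c) * χ (inner d c))

  -- translating the summation variable by a codeword y multiplies by χ⟨d,y⟩
  charSum-shift : ∀ d y → C y ≡ true → charSum d ≡ χ (inner d y) * charSum d
  charSum-shift d y y∈C = begin
    charSum d                                                      ≡⟨ sym (sumV-translate n y _) ⟩
    sumV n (λ c → 𝟙 (C (addV c y)) * χ (inner d (addV c y)))        ≡⟨ sum-cong (allVecs n) shifted ⟩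
    sumV n (λ c → χ (inner d y) * (𝟙 (C c) * χ (inner d c)))        ≡⟨ sum-scale (allVecs n) (χ (inner d y)) (λ c → 𝟙 (C c) * χ (inner d c)) ⟩
    χ (inner d y) * charSum d                                      ∎
    where
    open ≡-Reasoning
    regroup : ∀ a b e → a * (b * e) ≡ e * (a * b)
    regroup = solve-∀ ℚ-ring
    shifted : ∀ c → 𝟙 (C (addV c y)) * χ (inner d (addV c y)) ≡ χ (inner d y) * (𝟙 (C c) * χ (inner d c))
    shifted c rewrite translate-invariant y y∈C c | χ-inner-addʳ d c y = regroup (𝟙 (C c)) (χ (inner d c)) (χ (inner d y))

  charSum-dual : ∀ d → charSum d ≡ 𝟙 (C d) * size
  charSum-dual d with C d in d∈C?
  ... | true = trans (sum-cong (allVecs n) trivial-character) (sym (ℚ.*-identityˡ size))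
    where
    trivial-character : ∀ c → 𝟙 (C c) * χ (inner d c) ≡ 𝟙 (C c)
    trivial-character c with C c in c∈C?
    ... | true  rewrite proj₁ (selfDual d) d∈C? c c∈C? = refl
    ... | false = ℚ.*-zeroˡ (χ (inner d c))
  ... | false with charSum d ℚ.≟ 0ℚ
  ...   | yes vanishes = trans vanishes (sym (ℚ.*-zeroˡ size))
  ...   | no nonzero   = ⊥-elim (notMember (proj₂ (selfDual d) orthogonal))
    where
    notMember : ¬ C d ≡ true
    notMember d∈C with trans (sym d∈C?) d∈C
    ... | ()
    orthogonal : ∀ y → C y ≡ true → inner d y ≡ false
    orthogonal y y∈C = χ-fixes-nonzero (charSum d) (inner d y) nonzero (charSum-shift d y y∈C)

  codeSum : (L → ℚ) → ℚ
  codeSum f = sumV n (λ c → 𝟙 (C c) * prodF f c)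

  macWilliams : ∀ f → codeSum (hat f) ≡ size * codeSum f
  macWilliams f = begin
    sumV n (λ c → 𝟙 (C c) * prodF (hat f) c)
      ≡⟨ sum-cong (allVecs n) (λ c → cong (𝟙 (C c) *_) (sym (prodF-hat n f c))) ⟩
    sumV n (λ c → 𝟙 (C c) * sumV n (λ d → χ (inner d c) * prodF f d))
      ≡⟨ sum-cong (allVecs n) (λ c → sym (sum-scale (allVecs n) (𝟙 (C c)) _)) ⟩
    sumV n (λ c → sumV n (λ d → 𝟙 (C c) * (χ (inner d c) * prodF f d)))
      ≡⟨ sum-swap (allVecs n) (allVecs n) _ ⟩
    sumV n (λ d → sumV n (λ c → 𝟙 (C c) * (χ (inner d c) * prodF f d)))
      ≡⟨ sum-cong (allVecs n) (λ d → sum-cong (allVecs n) (λ c → regroup (𝟙 (C c)) (χ (inner d c)) (prodF f d))) ⟩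
    sumV n (λ d → sumV n (λ c → prodF f d * (𝟙 (C c) * χ (inner d c))))
      ≡⟨ sum-cong (allVecs n) (λ d → sum-scale (allVecs n) (prodF f d) _) ⟩
    sumV n (λ d → prodF f d * charSum d)
      ≡⟨ sum-cong (allVecs n) (λ d → trans (cong (prodF f d *_) (charSum-dual d)) (reverse (prodF f d) (𝟙 (C d)) size)) ⟩
    sumV n (λ d → size * (𝟙 (C d) * prodF f d))
      ≡⟨ sum-scale (allVecs n) size _ ⟩
    size * codeSum f
      ∎
    where
    open ≡-Reasoning
    regroup : ∀ a b e → a * (b * e) ≡ e * (a * b)
    regroup = solve-∀ ℚ-ring
    reverse : ∀ a b e → a * (b * e) ≡ e * (b * a)
    reverse = solve-∀ ℚ-ring

-- The symmetrized weight enumerator is invariant under T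

Point : Set
Point = ℚ × ℚ × ℚ

letter : Point → L → ℚ
letter (x , y , z) o  = x
letter (x , y , z) one = y
letter (x , y , z) ω  = z
letter (x , y , z) ω̄  = z

monoV-cons : ∀ x y z a {m} (v : Vec L m) → letter (x , y , z) a * monoV x y z v ≡ monoV x y z (a ∷ v)
monoV-cons x y z = L-elim (λ v → refl) (λ v → refl) (λ v → refl) (λ v → refl)

monoV≡prodF : ∀ x y z {m} (v : Vec L m) → monoV x y z v ≡ prodF (letter (x , y , z)) v
monoV≡prodF x y z []      = refl
monoV≡prodF x y z (a ∷ v) = trans (sym (monoV-cons x y z a v)) (cong (letter (x , y , z) a *_) (monoV≡prodF x y z v))

codewords : (n : ℕ) → (Vec L n → Bool) → List (Vec L n)
codewords n C = filter (λ v → C v ≟ true) (allVecs n)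

sweAt : (n : ℕ) → (Vec L n → Bool) → Point → ℚ
sweAt n C (x , y , z) = swe n C x y z

T : Point → Point
T (x , y , z) = (½ * (x + y) + z , ½ * (x + y) - z , ½ * (x - y))

T-involutive : ∀ p → T (T p) ≡ p
T-involutive (x , y , z) = cong₂ _,_ (first x y z) (cong₂ _,_ (second x y z) (third x y z))
  where
  first : ∀ x y z → ½ * ((½ * (x + y) + z) + (½ * (x + y) - z)) + ½ * (x - y) ≡ x
  first = solve-∀ ℚ-ring
  second : ∀ x y z → ½ * ((½ * (x + y) + z) + (½ * (x + y) - z)) - ½ * (x - y) ≡ y
  second = solve-∀ ℚ-ring
  third : ∀ x y z → ½ * ((½ * (x + y) + z) - (½ * (x + y) - z)) ≡ z
  third = solve-∀ ℚ-ring

-- the Fourier transform of the letter weights is twice the letter weights at T p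
-- (the left-hand sides below are hat (letter p) a computed out)
hat-letter : ∀ p a → hat (letter p) a ≡ 2ℚ * letter (T p) a
hat-letter (x , y , z) o  = at₀ x y z
  where
  at₀ : ∀ x y z → 1ℚ * x + (1ℚ * y + (1ℚ * z + (1ℚ * z + 0ℚ))) ≡ 2ℚ * (½ * (x + y) + z)
  at₀ = solve-∀ ℚ-ring
hat-letter (x , y , z) one = at₁ x y z
  where
  at₁ : ∀ x y z → 1ℚ * x + (1ℚ * y + (- 1ℚ * z + (- 1ℚ * z + 0ℚ))) ≡ 2ℚ * (½ * (x + y) - z)
  at₁ = solve-∀ ℚ-ring
hat-letter (x , y , z) ω  = at₂ x y z
  where
  at₂ : ∀ x y z → 1ℚ * x + (- 1ℚ * y + (1ℚ * z + (- 1ℚ * z + 0ℚ))) ≡ 2ℚ * (½ * (x - y))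
  at₂ = solve-∀ ℚ-ring
hat-letter (x , y , z) ω̄  = at₃ x y z
  where
  at₃ : ∀ x y z → 1ℚ * x + (- 1ℚ * y + (- 1ℚ * z + (1ℚ * z + 0ℚ))) ≡ 2ℚ * (½ * (x - y))
  at₃ = solve-∀ ℚ-ring

prodF-cong : ∀ {f g : L → ℚ} → (∀ a → f a ≡ g a) → ∀ {m} (v : Vec L m) → prodF f v ≡ prodF g v
prodF-cong f≗g []      = refl
prodF-cong f≗g (a ∷ v) = cong₂ _*_ (f≗g a) (prodF-cong f≗g v)

prodF-scale : ∀ k (g : L → ℚ) {m} (v : Vec L m) → prodF (λ a → k * g a) v ≡ (k ^ m) * prodF g v
prodF-scale k g []              = sym (ℚ.*-identityˡ 1ℚ)
prodF-scale k g {suc m} (a ∷ v) = trans (cong (k * g a *_) (prodF-scale k g v)) (regroup k (g a) (k ^ m) (prodF g v))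
  where
  regroup : ∀ k g K P → k * g * (K * P) ≡ k * K * (g * P)
  regroup = solve-∀ ℚ-ring

*-cancelˡ-pos : ∀ c a b → 0ℚ < c → c * a ≡ c * b → a ≡ b
*-cancelˡ-pos c a b 0<c ca≡cb = begin
  a                ≡⟨ sym (unit a) ⟩
  (1/ c) * (c * a) ≡⟨ cong ((1/ c) *_) ca≡cb ⟩
  (1/ c) * (c * b) ≡⟨ unit b ⟩
  b                ∎
  where
  open ≡-Reasoning
  instance
    c≢0 : NonZero c
    c≢0 = ℚ.pos⇒nonZero c {{positive 0<c}}
  unit : ∀ e → (1/ c) * (c * e) ≡ e
  unit e = trans (sym (ℚ.*-assoc (1/ c) c e)) (trans (cong (_* e) (ℚ.*-inverseˡ c)) (ℚ.*-identityˡ e))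

symmetric-cancel : ∀ P K a b → 0ℚ < P + K → P * a ≡ K * b → P * b ≡ K * a → a ≡ b
symmetric-cancel P K a b pos Pa≡Kb Pb≡Ka = *-cancelˡ-pos (P + K) a b pos (begin
  (P + K) * a   ≡⟨ ℚ.*-distribʳ-+ a P K ⟩
  P * a + K * a ≡⟨ cong (_+ K * a) Pa≡Kb ⟩
  K * b + K * a ≡⟨ ℚ.+-comm (K * b) (K * a) ⟩
  K * a + K * b ≡⟨ cong (_+ K * b) (sym Pb≡Ka) ⟩
  P * b + K * b ≡⟨ sym (ℚ.*-distribʳ-+ b P K) ⟩
  (P + K) * b   ∎)
  where open ≡-Reasoning

pow2-positive : ∀ m → Positive (2ℚ ^ m)
pow2-positive zero    = _
pow2-positive (suc m) = ℚ.pos*pos⇒pos 2ℚ (2ℚ ^ m) {{pow2-positive m}}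

module SweInvariance {n : ℕ} {C : Vec L n → Bool} (code : IsLCode n C) (selfDual : IsSelfDual n C) where
  open SelfDualCode code selfDual

  sweAt≡codeSum : ∀ p → sweAt n C p ≡ codeSum (letter p)
  sweAt≡codeSum (x , y , z) = trans (sum-filter C (monoV x y z) (allVecs n))
    (sum-cong (allVecs n) (λ v → cong (𝟙 (C v) *_) (monoV≡prodF x y z v)))

  swe-transform : ∀ p → (2ℚ ^ n) * sweAt n C (T p) ≡ size * sweAt n C p
  swe-transform p = begin
    (2ℚ ^ n) * sweAt n C (T p)                                ≡⟨ cong ((2ℚ ^ n) *_) (sweAt≡codeSum (T p)) ⟩
    (2ℚ ^ n) * codeSum (letter (T p))                         ≡⟨ sym (sum-scale (allVecs n) (2ℚ ^ n) _) ⟩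
    sumV n (λ c → (2ℚ ^ n) * (𝟙 (C c) * prodF (letter (T p)) c)) ≡⟨ sum-cong (allVecs n) scaled ⟩
    codeSum (hat (letter p))                                  ≡⟨ macWilliams (letter p) ⟩
    size * codeSum (letter p)                                 ≡⟨ cong (size *_) (sym (sweAt≡codeSum p)) ⟩
    size * sweAt n C p                                        ∎
    where
    open ≡-Reasoning
    regroup : ∀ a b e → a * (b * e) ≡ b * (a * e)
    regroup = solve-∀ ℚ-ring
    scaled : ∀ c → (2ℚ ^ n) * (𝟙 (C c) * prodF (letter (T p)) c) ≡ 𝟙 (C c) * prodF (hat (letter p)) c
    scaled c = trans (regroup (2ℚ ^ n) (𝟙 (C c)) (prodF (letter (T p)) c)) (cong (𝟙 (C c) *_) (begin
      (2ℚ ^ n) * prodF (letter (T p)) c       ≡⟨ sym (prodF-scale 2ℚ (letter (T p)) c) ⟩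
      prodF (λ a → 2ℚ * letter (T p) a) c     ≡⟨ sym (prodF-cong (hat-letter p) c) ⟩
      prodF (hat (letter p)) c                ∎))

  size-positive : 0ℚ < (2ℚ ^ n) + size
  size-positive = ℚ.+-mono-<-≤ (ℚ.positive⁻¹ (2ℚ ^ n) {{pow2-positive n}}) (sum-𝟙-nonneg C (allVecs n))

  -- swe is T-invariant: apply swe-transform at p and at T p, and use T (T p) = p
  swe-T-invariant : ∀ p → sweAt n C (T p) ≡ sweAt n C p
  swe-T-invariant p = symmetric-cancel (2ℚ ^ n) size (sweAt n C (T p)) (sweAt n C p) size-positive
    (swe-transform p)
    (trans (cong (λ q → (2ℚ ^ n) * sweAt n C q) (sym (T-involutive p))) (swe-transform (T p)))

Term : Set
Term = ℚ × ℕ × ℕ × ℕ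

evalT : Term → ℚ → ℚ → ℚ → ℚ
evalT (c , a , b , d) X₁ X₂ X₃ = c * ((X₁ ^ a) * ((X₂ ^ b) * (X₃ ^ d)))

^-+ : ∀ q a b → q ^ (a ℕ.+ b) ≡ (q ^ a) * (q ^ b)
^-+ q zero    b = sym (ℚ.*-identityˡ (q ^ b))
^-+ q (suc a) b = trans (cong (q *_) (^-+ q a b)) (sym (ℚ.*-assoc q (q ^ a) (q ^ b)))

mulT : Term → Term → Term
mulT (c , a , b , d) (c' , a' , b' , d') = (c * c' , a ℕ.+ a' , b ℕ.+ b' , d ℕ.+ d')

evalT-mul : ∀ s t X₁ X₂ X₃ → evalT (mulT s t) X₁ X₂ X₃ ≡ evalT s X₁ X₂ X₃ * evalT t X₁ X₂ X₃
evalT-mul (c , a , b , d) (c' , a' , b' , d') X₁ X₂ X₃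
  rewrite ^-+ X₁ a a' | ^-+ X₂ b b' | ^-+ X₃ d d' =
  regroup c c' (X₁ ^ a) (X₁ ^ a') (X₂ ^ b) (X₂ ^ b') (X₃ ^ d) (X₃ ^ d')
  where
  regroup : ∀ c c' A A' B B' D D' →
            c * c' * (A * A' * (B * B' * (D * D'))) ≡ c * (A * (B * D)) * (c' * (A' * (B' * D')))
  regroup = solve-∀ ℚ-ring

wdeg-mul : ∀ s t → wdeg (mulT s t) ≡ wdeg s ℕ.+ wdeg t
wdeg-mul (c , a , b , d) (c' , a' , b' , d') = additive a b d a' b' d'
  where
  additive : ∀ a b d a' b' d' →
             a ℕ.+ a' ℕ.+ (b ℕ.+ b') ℕ.+ 2 ℕ.* (d ℕ.+ d') ≡ a ℕ.+ b ℕ.+ 2 ℕ.* d ℕ.+ (a' ℕ.+ b' ℕ.+ 2 ℕ.* d')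
  additive = ℕ-Ring.solve-∀

mulP : Poly3 → Poly3 → Poly3
mulP []      q = []
mulP (s ∷ p) q = map (mulT s) q ++ mulP p q

evalP-++ : ∀ p q X₁ X₂ X₃ → evalP (p ++ q) X₁ X₂ X₃ ≡ evalP p X₁ X₂ X₃ + evalP q X₁ X₂ X₃
evalP-++ p q X₁ X₂ X₃ = trans (cong sumℚ (map-++ (λ t → evalT t X₁ X₂ X₃) p q))
                                (sum-++ (map (λ t → evalT t X₁ X₂ X₃) p) (map (λ t → evalT t X₁ X₂ X₃) q))

evalP-mul : ∀ p q X₁ X₂ X₃ → evalP (mulP p q) X₁ X₂ X₃ ≡ evalP p X₁ X₂ X₃ * evalP q X₁ X₂ X₃
evalP-mul []      q X₁ X₂ X₃ = sym (ℚ.*-zeroˡ (evalP q X₁ X₂ X₃))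
evalP-mul (s ∷ p) q X₁ X₂ X₃ = begin
  evalP (map (mulT s) q ++ mulP p q) X₁ X₂ X₃       ≡⟨ evalP-++ (map (mulT s) q) (mulP p q) X₁ X₂ X₃ ⟩
  evalP (map (mulT s) q) X₁ X₂ X₃ + evalP (mulP p q) X₁ X₂ X₃
    ≡⟨ cong₂ _+_ (trans (cong sumℚ (sym (map-∘ q))) (trans (sum-cong q (λ t → evalT-mul s t X₁ X₂ X₃)) (sum-scale q S (λ t → evalT t X₁ X₂ X₃))))
                 (evalP-mul p q X₁ X₂ X₃) ⟩
  S * Q + evalP p X₁ X₂ X₃ * Q                      ≡⟨ sym (ℚ.*-distribʳ-+ Q S (evalP p X₁ X₂ X₃)) ⟩
  (S + evalP p X₁ X₂ X₃) * Q                        ∎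
  where
  open ≡-Reasoning
  S Q : ℚ
  S = evalT s X₁ X₂ X₃
  Q = evalP q X₁ X₂ X₃

Hom : ℕ → Poly3 → Set
Hom k p = All (λ t → wdeg t ≡ k) p

All-mulP : ∀ {P R S : Term → Set} → (∀ s t → P s → R t → S (mulT s t)) →
           ∀ {p q} → All P p → All R q → All S (mulP p q)
All-mulP f {[]}    []       rq = []
All-mulP f {s ∷ p} (ps ∷ pp) rq = All.++⁺ (All.map⁺ (All.map (f s _ ps) rq)) (All-mulP f pp rq)

hom-mul : ∀ {j k p q} → Hom j p → Hom k q → Hom (j ℕ.+ k) (mulP p q)
hom-mul = All-mulP (λ s t s∈j t∈k → trans (wdeg-mul s t) (cong₂ ℕ._+_ s∈j t∈k))

-- The quadratic extension ℚ[X₁,X₂,X₃] ⊕ w·ℚ[X₁,X₂,X₃] with w² = Q(X₁,X₂,X₃)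

Ext : Set
Ext = Poly3 × Poly3

evalExt : Ext → ℚ → ℚ → ℚ → ℚ → ℚ
evalExt (A , B) X₁ X₂ X₃ W = evalP A X₁ X₂ X₃ + W * evalP B X₁ X₂ X₃

4ℚ 3ℚ ¼ ¾ : ℚ
4ℚ = ℤ.+ 4 / 1
3ℚ = ℤ.+ 3 / 1
¼  = ℤ.+ 1 / 4
¾  = ℤ.+ 3 / 4

Qpoly : Poly3
Qpoly = (4ℚ , 0 , 0 , 1) ∷ (- 3ℚ , 2 , 0 , 0) ∷ (- 4ℚ , 0 , 2 , 0) ∷ (4ℚ , 1 , 1 , 0) ∷ []

hom-Q : Hom 2 Qpoly
hom-Q = refl ∷ refl ∷ refl ∷ refl ∷ []

-- (the left-hand side is evalP Qpoly computed out)
evalP-Q : ∀ X₁ X₂ X₃ → evalP Qpoly X₁ X₂ X₃ ≡ 4ℚ * X₃ - 3ℚ * (X₁ * X₁) - 4ℚ * (X₂ * X₂) + 4ℚ * (X₁ * X₂)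
evalP-Q = computed
  where
  computed : ∀ X₁ X₂ X₃ →
    4ℚ * (1ℚ * (1ℚ * (X₃ * 1ℚ))) + (- 3ℚ * (X₁ * (X₁ * 1ℚ) * (1ℚ * 1ℚ)) +
      (- 4ℚ * (1ℚ * (X₂ * (X₂ * 1ℚ) * 1ℚ)) + (4ℚ * (X₁ * 1ℚ * (X₂ * 1ℚ * 1ℚ)) + 0ℚ)))
    ≡ 4ℚ * X₃ - 3ℚ * (X₁ * X₁) - 4ℚ * (X₂ * X₂) + 4ℚ * (X₁ * X₂)
  computed = solve-∀ ℚ-ring

addExt : Ext → Ext → Ext
addExt (A , B) (A' , B') = (A ++ A' , B ++ B')

mulExt : Ext → Ext → Ext
mulExt (A , B) (A' , B') = (mulP A A' ++ mulP Qpoly (mulP B B') , mulP A B' ++ mulP B A')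

evalExt-add : ∀ e e' X₁ X₂ X₃ W → evalExt (addExt e e') X₁ X₂ X₃ W ≡ evalExt e X₁ X₂ X₃ W + evalExt e' X₁ X₂ X₃ W
evalExt-add (A , B) (A' , B') X₁ X₂ X₃ W
  rewrite evalP-++ A A' X₁ X₂ X₃ | evalP-++ B B' X₁ X₂ X₃ =
  regroup (evalP A X₁ X₂ X₃) (evalP A' X₁ X₂ X₃) (evalP B X₁ X₂ X₃) (evalP B' X₁ X₂ X₃) W
  where
  regroup : ∀ a a' b b' w → a + a' + w * (b + b') ≡ a + w * b + (a' + w * b')
  regroup = solve-∀ ℚ-ring

evalExt-mul : ∀ e e' X₁ X₂ X₃ W → W * W ≡ evalP Qpoly X₁ X₂ X₃ →
              evalExt (mulExt e e') X₁ X₂ X₃ W ≡ evalExt e X₁ X₂ X₃ W * evalExt e' X₁ X₂ X₃ W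
evalExt-mul (A , B) (A' , B') X₁ X₂ X₃ W W²≡Q
  rewrite evalP-++ (mulP A A') (mulP Qpoly (mulP B B')) X₁ X₂ X₃ | evalP-++ (mulP A B') (mulP B A') X₁ X₂ X₃
        | evalP-mul A A' X₁ X₂ X₃ | evalP-mul Qpoly (mulP B B') X₁ X₂ X₃ | evalP-mul B B' X₁ X₂ X₃
        | evalP-mul A B' X₁ X₂ X₃ | evalP-mul B A' X₁ X₂ X₃ | sym W²≡Q =
  expand (evalP A X₁ X₂ X₃) (evalP A' X₁ X₂ X₃) (evalP B X₁ X₂ X₃) (evalP B' X₁ X₂ X₃) W
  where
  expand : ∀ a a' b b' w → a * a' + w * w * (b * b') + w * (a * b' + b * a') ≡ (a + w * b) * (a' + w * b')
  expand = solve-∀ ℚ-ring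

HomExt : ℕ → Ext → Set
HomExt k (A , B) = Hom k A × All (λ t → suc (wdeg t) ≡ k) B

homExt-add : ∀ {k} e e' → HomExt k e → HomExt k e' → HomExt k (addExt e e')
homExt-add (A , B) (A' , B') (hA , hB) (hA' , hB') = All.++⁺ hA hA' , All.++⁺ hB hB'

homExt-mul : ∀ {j k} e e' → HomExt j e → HomExt k e' → HomExt (j ℕ.+ k) (mulExt e e')
homExt-mul {j} {k} (A , B) (A' , B') (hA , hB) (hA' , hB') =
    All.++⁺ (hom-mul hA hA') (All-mulP (λ s t → Q·BB s t) hom-Q (All-mulP (λ s t → B·B s t) hB hB'))
  , All.++⁺ (All-mulP (λ s t → A·B s t) hA hB') (All-mulP (λ s t → B·A s t) hB hA')
  where
  B·B : ∀ s t → suc (wdeg s) ≡ j → suc (wdeg t) ≡ k → suc (suc (wdeg (mulT s t))) ≡ j ℕ.+ k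
  B·B s t refl refl rewrite wdeg-mul s t = cong suc (sym (ℕ.+-suc (wdeg s) (wdeg t)))
  Q·BB : ∀ s t → wdeg s ≡ 2 → suc (suc (wdeg t)) ≡ j ℕ.+ k → wdeg (mulT s t) ≡ j ℕ.+ k
  Q·BB s t s∈2 t∈j+k rewrite wdeg-mul s t | s∈2 = t∈j+k
  A·B : ∀ s t → wdeg s ≡ j → suc (wdeg t) ≡ k → suc (wdeg (mulT s t)) ≡ j ℕ.+ k
  A·B s t refl refl rewrite wdeg-mul s t = sym (ℕ.+-suc (wdeg s) (wdeg t))
  B·A : ∀ s t → suc (wdeg s) ≡ j → wdeg t ≡ k → suc (wdeg (mulT s t)) ≡ j ℕ.+ k
  B·A s t refl refl rewrite wdeg-mul s t = refl

even-part : ∀ e X₁ X₂ X₃ W s → evalExt e X₁ X₂ X₃ W ≡ s → evalExt e X₁ X₂ X₃ (- W) ≡ s →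
            s ≡ evalP (proj₁ e) X₁ X₂ X₃
even-part (A , B) X₁ X₂ X₃ W s at-W at-−W = begin
  s                                  ≡⟨ halve s ⟩
  ½ * (s + s)                        ≡⟨ cong₂ (λ l r → ½ * (l + r)) (sym at-W) (sym at-−W) ⟩
  ½ * ((a + W * b) + (a + - W * b))  ≡⟨ cancel a W b ⟩
  a                                  ∎
  where
  open ≡-Reasoning
  a b : ℚ
  a = evalP A X₁ X₂ X₃
  b = evalP B X₁ X₂ X₃
  halve : ∀ s → s ≡ ½ * (s + s)
  halve = solve-∀ ℚ-ring
  cancel : ∀ a w b → ½ * ((a + w * b) + (a + - w * b)) ≡ a
  cancel = solve-∀ ℚ-ring

-- swe as an element A + w·B of the quadratic extension

u₁ u₂ u₃ w : Point → ℚ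
u₁ (x , y , z) = x + y
u₂ (x , y , z) = x + z
u₃ (x , y , z) = (x * x) + ((y * y) + (2ℚ * (z * z)))
w  (x , y , z) = x - y - (z + z)

evalAt : Ext → Point → ℚ
evalAt e p = evalExt e (u₁ p) (u₂ p) (u₃ p) (w p)

w-squared : ∀ p → w p * w p ≡ evalP Qpoly (u₁ p) (u₂ p) (u₃ p)
w-squared (x , y , z) = trans (identity x y z) (sym (evalP-Q (x + y) (x + z) (x * x + (y * y + 2ℚ * (z * z)))))
  where
  identity : ∀ x y z → (x - y - (z + z)) * (x - y - (z + z)) ≡
    4ℚ * (x * x + (y * y + 2ℚ * (z * z))) - 3ℚ * ((x + y) * (x + y)) - 4ℚ * ((x + z) * (x + z)) + 4ℚ * ((x + y) * (x + z))
  identity = solve-∀ ℚ-ring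

evalAt-T : ∀ e p → evalAt e (T p) ≡ evalExt e (u₁ p) (u₂ p) (u₃ p) (- w p)
evalAt-T e (x , y , z) = evalExt-cong (fix₁ x y z) (fix₂ x y z) (fix₃ x y z) (negate x y z)
  where
  evalExt-cong : ∀ {X₁ X₁' X₂ X₂' X₃ X₃' W W'} → X₁ ≡ X₁' → X₂ ≡ X₂' → X₃ ≡ X₃' → W ≡ W' →
                 evalExt e X₁ X₂ X₃ W ≡ evalExt e X₁' X₂' X₃' W'
  evalExt-cong refl refl refl refl = refl
  fix₁ : ∀ x y z → (½ * (x + y) + z) + (½ * (x + y) - z) ≡ x + y
  fix₁ = solve-∀ ℚ-ring
  fix₂ : ∀ x y z → (½ * (x + y) + z) + ½ * (x - y) ≡ x + z
  fix₂ = solve-∀ ℚ-ring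
  fix₃ : ∀ x y z → (½ * (x + y) + z) * (½ * (x + y) + z) + ((½ * (x + y) - z) * (½ * (x + y) - z) + 2ℚ * (½ * (x - y) * (½ * (x - y))))
                 ≡ x * x + (y * y + 2ℚ * (z * z))
  fix₃ = solve-∀ ℚ-ring
  negate : ∀ x y z → (½ * (x + y) + z) - (½ * (x + y) - z) - (½ * (x - y) + ½ * (x - y)) ≡ - (x - y - (z + z))
  negate = solve-∀ ℚ-ring

linear : ℚ → ℚ → ℚ → Ext
linear a b c = ((a , 1 , 0 , 0) ∷ (b , 0 , 1 , 0) ∷ [] , (c , 0 , 0 , 0) ∷ [])

-- (the left-hand side is evalExt (linear a b c) computed out)
evalExt-linear : ∀ a b c X₁ X₂ X₃ W → evalExt (linear a b c) X₁ X₂ X₃ W ≡ a * X₁ + b * X₂ + c * W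
evalExt-linear = computed
  where
  computed : ∀ a b c X₁ X₂ X₃ W →
    a * (X₁ * 1ℚ * (1ℚ * 1ℚ)) + (b * (1ℚ * (X₂ * 1ℚ * 1ℚ)) + 0ℚ) + W * (c * (1ℚ * (1ℚ * 1ℚ)) + 0ℚ)
    ≡ a * X₁ + b * X₂ + c * W
  computed = solve-∀ ℚ-ring

letterExt : L → Ext
letterExt o  = linear ¼ ½ ¼
letterExt one = linear ¾ (- ½) (- ¼)
letterExt ω  = linear (- ¼) ½ (- ¼)
letterExt ω̄  = linear (- ¼) ½ (- ¼)

evalAt-letter : ∀ p a → evalAt (letterExt a) p ≡ letter p a
evalAt-letter (x , y , z) o  = trans (evalExt-linear ¼ ½ ¼ (u₁ (x , y , z)) (u₂ (x , y , z)) (u₃ (x , y , z)) (w (x , y , z)))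
                                          (weight₀ x y z)
  where
  weight₀ : ∀ x y z → ¼ * (x + y) + ½ * (x + z) + ¼ * (x - y - (z + z)) ≡ x
  weight₀ = solve-∀ ℚ-ring
evalAt-letter (x , y , z) one = trans (evalExt-linear ¾ (- ½) (- ¼) (u₁ (x , y , z)) (u₂ (x , y , z)) (u₃ (x , y , z)) (w (x , y , z)))
                                          (weight₁ x y z)
  where
  weight₁ : ∀ x y z → ¾ * (x + y) + - ½ * (x + z) + - ¼ * (x - y - (z + z)) ≡ y
  weight₁ = solve-∀ ℚ-ring
evalAt-letter (x , y , z) ω  = trans (evalExt-linear (- ¼) ½ (- ¼) (u₁ (x , y , z)) (u₂ (x , y , z)) (u₃ (x , y , z)) (w (x , y , z)))
                                          (weight₂ x y z)
  where
  weight₂ : ∀ x y z → - ¼ * (x + y) + ½ * (x + z) + - ¼ * (x - y - (z + z)) ≡ z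
  weight₂ = solve-∀ ℚ-ring
evalAt-letter p ω̄ = evalAt-letter p ω

homExt-letter : ∀ a → HomExt 1 (letterExt a)
homExt-letter = L-elim homLinear homLinear homLinear homLinear
  where
  homLinear : ∀ {a b c} → HomExt 1 (linear a b c)
  homLinear = (refl ∷ refl ∷ []) , (refl ∷ [])

wordExt : ∀ {m} → Vec L m → Ext
wordExt []      = ((1ℚ , 0 , 0 , 0) ∷ [] , [])
wordExt (a ∷ v) = mulExt (letterExt a) (wordExt v)

homExt-word : ∀ {m} (v : Vec L m) → HomExt m (wordExt v)
homExt-word []      = (refl ∷ []) , []
homExt-word (a ∷ v) = homExt-mul (letterExt a) (wordExt v) (homExt-letter a) (homExt-word v)

evalAt-word : ∀ x y z {m} (v : Vec L m) → evalAt (wordExt v) (x , y , z) ≡ monoV x y z v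
evalAt-word x y z []      = unit (x - y - (z + z))
  where
  unit : ∀ W → 1ℚ * (1ℚ * (1ℚ * 1ℚ)) + 0ℚ + W * 0ℚ ≡ 1ℚ
  unit = solve-∀ ℚ-ring
evalAt-word x y z (a ∷ v) = begin
  evalAt (mulExt (letterExt a) (wordExt v)) p
    ≡⟨ evalExt-mul (letterExt a) (wordExt v) (u₁ p) (u₂ p) (u₃ p) (w p) (w-squared p) ⟩
  evalAt (letterExt a) p * evalAt (wordExt v) p  ≡⟨ cong₂ _*_ (evalAt-letter p a) (evalAt-word x y z v) ⟩
  letter p a * monoV x y z v                     ≡⟨ monoV-cons x y z a v ⟩
  monoV x y z (a ∷ v)                            ∎
  where
  open ≡-Reasoning
  p : Point
  p = (x , y , z)

wordsExt : ∀ {m} → List (Vec L m) → Ext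
wordsExt []      = ([] , [])
wordsExt (v ∷ l) = addExt (wordExt v) (wordsExt l)

homExt-words : ∀ {m} (l : List (Vec L m)) → HomExt m (wordsExt l)
homExt-words []      = [] , []
homExt-words (v ∷ l) = homExt-add (wordExt v) (wordsExt l) (homExt-word v) (homExt-words l)

evalAt-words : ∀ x y z {m} (l : List (Vec L m)) → evalAt (wordsExt l) (x , y , z) ≡ sumℚ (map (monoV x y z) l)
evalAt-words x y z []      = trans (ℚ.+-identityˡ _) (ℚ.*-zeroʳ (x - y - (z + z)))
evalAt-words x y z (v ∷ l) =
  trans (evalExt-add (wordExt v) (wordsExt l) (u₁ p) (u₂ p) (u₃ p) (w p))
        (cong₂ _+_ (evalAt-word x y z v) (evalAt-words x y z l))
  where
  p : Point
  p = (x , y , z)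

swe≡evalAt : ∀ n C p → sweAt n C p ≡ evalAt (wordsExt (codewords n C)) p
swe≡evalAt n C (x , y , z) = sym (evalAt-words x y z (codewords n C))

theorem4p5 : (n : ℕ) (C : Vec L n → Bool) → IsLCode n C → IsSelfDual n C →
    Σ Poly3 λ F → All (λ t → wdeg t ≡ n) F ×
      (∀ x y z → swe n C x y z ≡ evalP F (x + y) (x + z) ((x * x) + ((y * y) + (2ℚ * (z * z)))))
theorem4p5 n C code selfDual = proj₁ enumerator , proj₁ (homExt-words (codewords n C)) , equals-A
  where
  open SweInvariance code selfDual
  enumerator : Ext
  enumerator = wordsExt (codewords n C)
  equals-A : ∀ x y z → swe n C x y z ≡ evalP (proj₁ enumerator) (x + y) (x + z) ((x * x) + ((y * y) + (2ℚ * (z * z))))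
  equals-A x y z = even-part enumerator (u₁ p) (u₂ p) (u₃ p) (w p) (sweAt n C p)
    (sym (swe≡evalAt n C p))
    (begin
      evalExt enumerator (u₁ p) (u₂ p) (u₃ p) (- w p) ≡⟨ sym (evalAt-T enumerator p) ⟩
      evalAt enumerator (T p)                          ≡⟨ sym (swe≡evalAt n C (T p)) ⟩
      sweAt n C (T p)                                  ≡⟨ swe-T-invariant p ⟩
      sweAt n C p                                      ∎)
    where
    open ≡-Reasoning
    p : Point
    p = (x , y , z)
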